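{- Let $p,q$ be distinct primes and $k\ge 1$ an integer, and let $n=qp^k$. Then $n$ is non-intersecting if and only if $k=1$ or $p>2$. Moreover, the density of any coprime disjoint congruence set of $n$ is $\dfrac{p^k-1}{p^k(p-1)}+\dfrac{1}{q}$.
   Context: Two congruences $a\bmod d$ and $a'\bmod d'$ overlap if some integer satisfies both. A set of congruences $\{a_1\bmod d_1,\ldots,a_t\bmod d_t\}$ is coprime disjoint (CD) if whenever $a_i\bmod d_i$ and $a_j\bmod d_j$ overlap for $i\neq j$, we have $\gcd(d_i,d_j)=1$. An integer $n$ is non-intersecting if there exist integers $\{a_d : d\mid n,\ d>1\}$ such that $\{a_d\bmod d : d\mid n,\ d>1\}$ is a CD congruence set; such a set is called a CD congruence set of $n$. For a congruence set $A$, let $A(N)$ be the number of positive integers $x\le N$ satisfying some congruence of $A$; the density of $A$ is $\delta(A)=\lim_{N\to\infty}A(N)/N$. -}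

module Defs where

open import Data.Nat as ℕ using (ℕ; zero; suc; _<_; _≤_; s≤s; z≤n)
open import Data.Nat.Properties using (<-≤-trans; ≤-<-trans)
open import Data.Nat.Divisibility using (_∣?_; ∣⇒≤) renaming (_∣_ to _∣ℕ_)
open import Data.Nat.GCD using (gcd)
open import Data.Integer as ℤ using (ℤ; +_; _-_; ∣_∣)
open import Data.Integer.Divisibility renaming (_∣_ to _∣ℤ_)
open import Data.Rational as ℚ using (ℚ; 0ℚ)
open import Data.List using (List; length; filter; map; upTo)
open import Data.Product using (∃; _×_; _,_)
open import Relation.Nullary using (Dec; yes; no; ¬_)
open import Relation.Nullary.Decidable using (map′; _×-dec_)
open import Relation.Binary.PropositionalEquality using (_≡_; _≢_)
open import Data.Nat.Properties using (anyUpTo?; _<?_)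

_≡_[mod_] : ℤ → ℤ → ℕ → Set
x ≡ a [mod d ] = (+ d) ∣ℤ (x - a)

Overlap : ℤ → ℕ → ℤ → ℕ → Set
Overlap a d a' d' = ∃ λ (x : ℤ) → (x ≡ a [mod d ]) × (x ≡ a' [mod d' ])

-- A choice of residues a_d (only the values at divisors d > 1 of n matter)
-- forms a coprime disjoint (CD) congruence set of n:
-- distinct congruences that overlap have coprime moduli.
IsCDSet : ℕ → (ℕ → ℤ) → Set
IsCDSet n a = ∀ d d' → d ∣ℕ n → 1 < d → d' ∣ℕ n → 1 < d' → d ≢ d' →
              Overlap (a d) d (a d') d' → gcd d d' ≡ 1

NonIntersecting : ℕ → Set
NonIntersecting n = ∃ λ (a : ℕ → ℤ) → IsCDSet n a

Covered : ℕ → (ℕ → ℤ) → ℤ → Set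
Covered n a x = ∃ λ d → d ∣ℕ n × 1 < d × (x ≡ a d [mod d ])

private
  Bounded : ℕ → (ℕ → ℤ) → ℤ → ℕ → Set
  Bounded n a x d = d ∣ℕ n × 1 < d × (x ≡ a d [mod d ])

  bounded? : ∀ n a x d → Dec (Bounded n a x d)
  bounded? n a x d = (d ∣? n) ×-dec ((1 <? d) ×-dec (d ∣? ∣ x - a d ∣))

covered? : ∀ n .{{_ : ℕ.NonZero n}} a x → Dec (Covered n a x)
covered? n a x = map′ to from (anyUpTo? (bounded? n a x) (suc n))
  where
  to : (∃ λ d → d < suc n × Bounded n a x d) → Covered n a x
  to (d , _ , b) = d , b
  from : Covered n a x → ∃ λ d → d < suc n × Bounded n a x d
  from (d , d∣n , b) = d , s≤s (∣⇒≤ d∣n) , d∣n , b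

-- A(N): number of positive integers x ≤ N satisfying some congruence of the set
-- (n = 0 never occurs in the statement; it is given the dummy value 0 so that
-- countA is total without a NonZero instance)
countA : ℕ → (ℕ → ℤ) → ℕ → ℕ
countA zero    a N = 0
countA (suc m) a N =
  length (filter (λ x → covered? (suc m) a (+ x)) (map suc (upTo N)))

-- m / d as a rational (d = 0 gives 0; only used with d ≠ 0)
_÷ℕ_ : ℕ → ℕ → ℚ
m ÷ℕ zero  = 0ℚ
m ÷ℕ suc d = + m ℚ./ suc d

HasDensity : (ℕ → ℕ) → ℚ → Set
HasDensity f r = ∀ (ε : ℚ) → 0ℚ ℚ.< ε →
  ∃ λ N₀ → ∀ N → N₀ ≤ N → N ≢ 0 → ℚ.∣ (f N ÷ℕ N) ℚ.- r ∣ ℚ.< ε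

-- For k ≥ 2 the moduli 2, 4 and 2q of n = q·2ᵏ pairwise share the factor 2, while any three
-- residues contain two that agree modulo 2; by the Chinese remainder theorem those two
-- congruences overlap, so no CD congruence set exists.  Conversely, for k = 1 or p > 2 the
-- residues a_{pʲ⁺¹} = 2pʲ, a_q = 0, a_{qpⁱ⁺¹} = pⁱ work: residues of different p-adic valuation, or
-- of equal valuation with units 2 and 1, never meet modulo the smaller power of p.
--
-- In any CD set of n, the congruences whose moduli are not coprime are disjoint, so the only
-- overlaps are between a_{pʲ⁺¹} and a_q.  By the Chinese remainder theorem each such overlap has
-- pᵏ⁻¹⁻ʲ elements per period n, exactly as many as the congruence modulo qpʲ⁺¹, so a period
-- contains q(1 + p + ⋯ + pᵏ⁻¹) + pᵏ covered residues.  A periodic set has density equal to its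
-- proportion in one period.

module Submission where

open import Defs
open import Level using (Level)
open import Data.Nat as ℕ
  using (ℕ; zero; suc; 2+; _+_; _*_; _^_; _∸_; _<_; _≤_; ∣_-_∣; z≤n; s≤s; z<s; NonZero)
open import Data.Nat.Properties
open import Data.Nat.DivMod using (_/_; _%_; m*n/n≡m; m/n<m; m<n⇒m/n≡0; m≡m%n+[m/n]*n; m%n<n)
open import Data.Nat.Divisibility as ℕ∣
  using (divides; _∣?_; _∣0; ∣-refl; ∣-trans; ∣1⇒≡1; m∣m*n; n∣m*n; ∣n⇒∣m*n; *-cancelʳ-∣)
  renaming (_∣_ to _∣ℕ_)
open import Data.Nat.Coprimality
  using (Coprime; coprime-divisor; coprime-factors; coprime-Bézout; 1-coprimeTo; prime⇒coprime;
         coprime⇒gcd≡1)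
  renaming (sym to coprime-sym)
open import Data.Nat.GCD using (gcd; gcd-greatest; gcd-comm; module Bézout)
open import Data.Nat.Primality using (Prime; prime⇒irreducible; prime⇒nonZero; prime⇒nonTrivial)
import Data.Nat.Tactic.RingSolver as ℕS
open import Data.Integer as ℤ using (ℤ; +_; +[1+_])
import Data.Integer.Properties as ℤP
import Data.Integer.Divisibility.Signed as ℤ∣
import Data.Integer.DivMod as ℤD
open import Data.Integer.Tactic.RingSolver using (solve-∀)
open import Data.Rational as ℚ using (mkℚ)
import Data.Rational.Properties as ℚP
open import Data.Rational.Unnormalised as ℚᵘ using (mkℚᵘ; *<*; *≡*)
import Data.Rational.Unnormalised.Properties as ℚᵘP
open import Data.List using (length; filter; map; upTo; applyUpTo)
open import Data.List.Properties using (map-upTo)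
open import Data.Product using (∃; _×_; _,_; proj₁; proj₂)
open import Data.Sum using (_⊎_; inj₁; inj₂; [_,_]′)
open import Data.Empty using (⊥; ⊥-elim)
open import Function.Base using (_∘_)
open import Function.Bundles using (_⇔_; mk⇔; Equivalence)
open import Relation.Nullary using (Dec; yes; no; ¬_; contradiction; _×-dec_)
open import Relation.Unary using (Pred; Decidable)
open import Relation.Binary.Definitions using (tri<; tri≈; tri>)
open import Relation.Binary.PropositionalEquality

private
  variable
    ℓ ℓ′ : Level
    A : Set ℓ
    B : Set ℓ′
    p q d d' k M N : ℕ
    f g : ℕ → ℕ


-- Primes and the divisors of q * p ^ k

prime⇒1< : Prime p → 1 < p
prime⇒1< {p} pp = ℕ.nonTrivial⇒n>1 p {{prime⇒nonTrivial pp}}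

prime∣prime⇒≡ : Prime p → Prime q → p ∣ℕ q → p ≡ q
prime∣prime⇒≡ pp pq p∣q with prime⇒irreducible pq p∣q
... | inj₁ refl = ⊥-elim (<-irrefl refl (prime⇒1< pp))
... | inj₂ p≡q = p≡q

prime∤⇒coprime : Prime p → ¬ p ∣ℕ d → Coprime d p
prime∤⇒coprime pp p∤d (i∣d , i∣p) with prime⇒irreducible pp i∣p
... | inj₁ i≡1 = i≡1
... | inj₂ refl = ⊥-elim (p∤d i∣d)

∣p^k⇒≡p^i : Prime p → ∀ k → d ∣ℕ p ^ k → ∃ λ i → i ≤ k × d ≡ p ^ i
∣p^k⇒≡p^i pp zero d∣1 = 0 , z≤n , ∣1⇒≡1 d∣1
∣p^k⇒≡p^i {p} {d} pp (suc k) d∣ with p ∣? d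
... | no p∤d with ∣p^k⇒≡p^i pp k (coprime-divisor (prime∤⇒coprime pp p∤d) d∣)
...   | i , i≤k , d≡p^i = i , m≤n⇒m≤1+n i≤k , d≡p^i
∣p^k⇒≡p^i {p} pp (suc k) d∣ | yes (divides e refl)
  with ∣p^k⇒≡p^i pp k (*-cancelʳ-∣ p {{prime⇒nonZero pp}} (subst (e * p ∣ℕ_) (*-comm p (p ^ k)) d∣))
... | i , i≤k , e≡p^i = suc i , s≤s i≤k , trans (*-comm e p) (cong (p *_) e≡p^i)

prime∤p^i : Prime p → Prime q → p ≢ q → ∀ i → ¬ q ∣ℕ p ^ i
prime∤p^i {p} pp pq p≢q i q∣p^i with ∣p^k⇒≡p^i pp i q∣p^i
... | zero  , _ , q≡1 = <-irrefl (sym q≡1) (prime⇒1< pq)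
... | suc j , _ , refl = p≢q (prime∣prime⇒≡ pp pq (m∣m*n (p ^ j)))

^-monoʳ-∣ : ∀ p {i j} → i ≤ j → p ^ i ∣ℕ p ^ j
^-monoʳ-∣ p {i} {j} i≤j = divides (p ^ (j ∸ i))
  (trans (cong (p ^_) (sym (m∸n+n≡m i≤j))) (^-distribˡ-+-* p (j ∸ i) i))

^-injectiveʳ : 1 < p → ∀ {i j} → p ^ i ≡ p ^ j → i ≡ j
^-injectiveʳ {p} 1<p {i} {j} p^i≡p^j with <-cmp i j
... | tri< i<j _ _ = ⊥-elim (<-irrefl p^i≡p^j (^-monoʳ-< p 1<p i<j))
... | tri≈ _ i≡j _ = i≡j
... | tri> _ _ j<i = ⊥-elim (<-irrefl (sym p^i≡p^j) (^-monoʳ-< p 1<p j<i))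

p^[1+i]∣u*p^i⇒p∣u : ∀ {p u} i → .{{NonZero p}} → p ^ suc i ∣ℕ u * p ^ i → p ∣ℕ u
p^[1+i]∣u*p^i⇒p∣u {p} i = *-cancelʳ-∣ (p ^ i) {{m^n≢0 p i}}

p^[1+i]∤p^i : 1 < p → ∀ i → ¬ p ^ suc i ∣ℕ p ^ i
p^[1+i]∤p^i {p} 1<p i =
  ℕ∣.>⇒∤ {{m^n≢0 p i {{ℕ.>-nonZero (<-trans z<s 1<p)}}}} (^-monoʳ-< p 1<p (n<1+n i))

data NontrivialDivisor (p q k d : ℕ) : Set where
  pPower       : ∀ j → j < k → d ≡ p ^ suc j → NontrivialDivisor p q k d
  qItself      : d ≡ q → NontrivialDivisor p q k d
  qTimesPPower : ∀ i → i < k → d ≡ q * p ^ suc i → NontrivialDivisor p q k d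

classifyDivisor : Prime p → Prime q → ∀ k → d ∣ℕ q * p ^ k → 1 < d → NontrivialDivisor p q k d
classifyDivisor {p} {q} {d} pp pq k d∣ 1<d with q ∣? d
... | yes (divides e refl)
  with ∣p^k⇒≡p^i {d = e} pp k
         (*-cancelʳ-∣ q {{prime⇒nonZero pq}} (subst (e * q ∣ℕ_) (*-comm q (p ^ k)) d∣))
...   | zero  , _   , refl = qItself (*-identityˡ q)
...   | suc i , i<k , refl = qTimesPPower i i<k (*-comm (p ^ suc i) q)
classifyDivisor pp pq k d∣ 1<d | no q∤d
  with ∣p^k⇒≡p^i pp k (coprime-divisor (prime∤⇒coprime pq q∤d) d∣)
... | zero  , _   , refl       = ⊥-elim (<-irrefl refl 1<d)
... | suc j , j<k , d≡p^[1+j] = pPower j j<k d≡p^[1+j]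

-- Congruences

≡-mod⇒∣ : ∀ x y → x ≡ y [mod d ] → + d ℤ∣.∣ (x ℤ.- y)
≡-mod⇒∣ {d} x y = ℤ∣.∣ᵤ⇒∣ {+ d} {x ℤ.- y}

∣⇒≡-mod : ∀ x y → + d ℤ∣.∣ (x ℤ.- y) → x ≡ y [mod d ]
∣⇒≡-mod {d} x y = ℤ∣.∣⇒∣ᵤ {+ d} {x ℤ.- y}

≡-mod-sym : ∀ x y → x ≡ y [mod d ] → y ≡ x [mod d ]
≡-mod-sym x y = subst (_ ∣ℕ_) (ℤP.∣i-j∣≡∣j-i∣ x y)

≡-mod-trans : ∀ x y z → x ≡ y [mod d ] → y ≡ z [mod d ] → x ≡ z [mod d ]
≡-mod-trans x y z x≡y y≡z = ∣⇒≡-mod x z (subst (_ ℤ∣.∣_) (telescope x y z)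
  (ℤ∣.∣m∣n⇒∣m+n (≡-mod⇒∣ x y x≡y) (≡-mod⇒∣ y z y≡z)))
  where
  telescope : ∀ x y z → (x ℤ.- y) ℤ.+ (y ℤ.- z) ≡ x ℤ.- z
  telescope = solve-∀

≡-mod-+-multiple : ∀ {e} (x : ℤ) → d ∣ℕ e → (x ℤ.+ + e) ≡ x [mod d ]
≡-mod-+-multiple {d} {e} x d∣e = subst (d ∣ℕ_) (cong ℤ.∣_∣ (sym (cancel x (+ e)))) d∣e
  where
  cancel : ∀ x e → (x ℤ.+ e) ℤ.- x ≡ e
  cancel = solve-∀

≡-mod-shift : ∀ {d e} x α → d ∣ℕ e → (+ (x + e)) ≡ α [mod d ] ⇔ (+ x) ≡ α [mod d ]
≡-mod-shift {d} {e} x α d∣e = mk⇔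
  (≡-mod-trans (+ x) (+ (x + e)) α (≡-mod-sym (+ (x + e)) (+ x) x+e≡x))
  (≡-mod-trans (+ (x + e)) (+ x) α x+e≡x)
  where
  x+e≡x : (+ (x + e)) ≡ (+ x) [mod d ]
  x+e≡x = subst (λ z → z ≡ (+ x) [mod d ]) (sym (ℤP.pos-+ x e)) (≡-mod-+-multiple (+ x) d∣e)

≡-mod-∣ : ∀ x y → (+ x) ≡ (+ y) [mod d ] → d ∣ℕ y → d ∣ℕ x
≡-mod-∣ {d} x y x≡y d∣y = ℤ∣.∣⇒∣ᵤ (subst (+ d ℤ∣.∣_) (cancel (+ x) (+ y))
  (ℤ∣.∣m∣n⇒∣m+n (≡-mod⇒∣ (+ x) (+ y) x≡y) (ℤ∣.∣ᵤ⇒∣ {+ d} {+ y} d∣y)))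
  where
  cancel : ∀ x y → (x ℤ.- y) ℤ.+ y ≡ x
  cancel = solve-∀

≡-mod-+ˡ⇒∣ : ∀ {x y} → (+ (x + y)) ≡ (+ y) [mod d ] → d ∣ℕ x
≡-mod-+ˡ⇒∣ {d} {x} {y} x+y≡y = ℤ∣.∣⇒∣ᵤ {+ d} {+ x}
  (subst (+ d ℤ∣.∣_) (trans (cong (ℤ._- + y) (ℤP.pos-+ x y)) (cancel (+ x) (+ y)))
    (≡-mod⇒∣ (+ (x + y)) (+ y) x+y≡y))
  where
  cancel : ∀ x y → (x ℤ.+ y) ℤ.- y ≡ x
  cancel = solve-∀

≡-mod⇒≡ : ∀ {x y} → x < d → y < d → (+ x) ≡ (+ y) [mod d ] → x ≡ y
≡-mod⇒≡ {d} {x} {y} x<d y<d x≡y with ℤ.∣ + x ℤ.- + y ∣ in eq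
... | zero  = ℤP.+-injective (ℤP.i-j≡0⇒i≡j (+ x) (+ y) (ℤP.∣i∣≡0⇒i≡0 eq))
... | suc m = ⊥-elim (<-irrefl refl (≤-<-trans (ℕ∣.∣⇒≤ x≡y) ∣x-y∣<d))
  where
  ∣x-y∣<d : suc m < d
  ∣x-y∣<d = begin-strict
    suc m             ≡⟨ sym eq ⟩
    ℤ.∣ + x ℤ.- + y ∣ ≡⟨ cong ℤ.∣_∣ (ℤP.m-n≡m⊖n x y) ⟩
    ℤ.∣ x ℤ.⊖ y ∣     ≤⟨ ℤP.∣m⊝n∣≤m⊔n x y ⟩
    x ℕ.⊔ y           <⟨ ⊔-lub x<d y<d ⟩
    d                 ∎
    where open ≤-Reasoning

≡-mod-representative : ∀ α d .{{_ : NonZero d}} → ∃ λ r → r < d × (+ r) ≡ α [mod d ]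
≡-mod-representative α d = α ℤD.%ℕ d , ℤD.n%ℕd<d α d ,
  ∣⇒≡-mod (+ r) α (ℤ∣.divides (ℤ.- t)
    (trans (cong (λ a → + r ℤ.- a) (ℤD.a≡a%ℕn+[a/ℕn]*n α d)) (cancel (+ r) t (+ d))))
  where
  r = α ℤD.%ℕ d
  t = α ℤD./ℕ d
  cancel : ∀ r t d → r ℤ.- (r ℤ.+ t ℤ.* d) ≡ (ℤ.- t) ℤ.* d
  cancel = solve-∀

≡-mod? : ∀ x a d → Dec (x ≡ a [mod d ])
≡-mod? x a d = d ∣? ℤ.∣ x ℤ.- a ∣

residues-mod-2 : ∀ x y z → x ≡ y [mod 2 ] ⊎ x ≡ z [mod 2 ] ⊎ y ≡ z [mod 2 ]
residues-mod-2 x y z =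
  pick (≡-mod-representative x 2) (≡-mod-representative y 2) (≡-mod-representative z 2)
  where
  Rep : ℤ → Set
  Rep u = ∃ λ r → r < 2 × (+ r) ≡ u [mod 2 ]
  via : ∀ r u v → (+ r) ≡ u [mod 2 ] → (+ r) ≡ v [mod 2 ] → u ≡ v [mod 2 ]
  via r u v r≡u r≡v = ≡-mod-trans u (+ r) v (≡-mod-sym (+ r) u r≡u) r≡v
  pick : Rep x → Rep y → Rep z → x ≡ y [mod 2 ] ⊎ x ≡ z [mod 2 ] ⊎ y ≡ z [mod 2 ]
  pick (0 , _ , rx) (0 , _ , ry) _            = inj₁ (via 0 x y rx ry)
  pick (1 , _ , rx) (1 , _ , ry) _            = inj₁ (via 1 x y rx ry)
  pick (0 , _ , rx) (1 , _ , _)  (0 , _ , rz) = inj₂ (inj₁ (via 0 x z rx rz))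
  pick (1 , _ , rx) (0 , _ , _)  (1 , _ , rz) = inj₂ (inj₁ (via 1 x z rx rz))
  pick (0 , _ , _)  (1 , _ , ry) (1 , _ , rz) = inj₂ (inj₂ (via 1 y z ry rz))
  pick (1 , _ , _)  (0 , _ , ry) (0 , _ , rz) = inj₂ (inj₂ (via 0 y z ry rz))
  pick (2+ _ , s≤s (s≤s ()) , _) _ _
  pick _ (2+ _ , s≤s (s≤s ()) , _) _
  pick _ _ (2+ _ , s≤s (s≤s ()) , _)

module _ {a a' : ℤ} {d d' : ℕ} where

  overlap-sym : Overlap a d a' d' → Overlap a' d' a d
  overlap-sym (x , x≡a , x≡a') = x , x≡a' , x≡a

  overlap-cong : ∀ {b b'} → a ≡ b → a' ≡ b' → Overlap a d a' d' → Overlap b d b' d'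
  overlap-cong refl refl ov = ov

overlap⇒≡-mod : ∀ a a' {d'} m → Overlap a d a' d' → m ∣ℕ d → m ∣ℕ d' → a ≡ a' [mod m ]
overlap⇒≡-mod a a' m (x , x≡a , x≡a') m∣d m∣d' =
  ≡-mod-trans a x a' (≡-mod-sym x a (∣-trans m∣d x≡a)) (∣-trans m∣d' x≡a')

-- The Chinese remainder theorem

coprime⇒inverse : Coprime d d' → ∃ λ u → (u ℤ.* + d) ≡ + 1 [mod d' ]
coprime⇒inverse {d} {d'} c with coprime-Bézout c
... | Bézout.+- x y 1+yd'≡xd = + x , ∣⇒≡-mod (+ x ℤ.* + d) (+ 1) (ℤ∣.divides (+ y) (begin
  + x ℤ.* + d ℤ.- + 1          ≡⟨ cong (ℤ._- + 1) (ℤP.pos-* x d) ⟨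
  + (x * d) ℤ.- + 1            ≡⟨ cong (λ m → + m ℤ.- + 1) 1+yd'≡xd ⟨
  + (1 + y * d') ℤ.- + 1       ≡⟨ cong (ℤ._- + 1) (ℤP.pos-+ 1 (y * d')) ⟩
  + 1 ℤ.+ + (y * d') ℤ.- + 1   ≡⟨ cancel (+ (y * d')) ⟩
  + (y * d')                   ≡⟨ ℤP.pos-* y d' ⟩
  + y ℤ.* + d'                 ∎))
  where
  open ≡-Reasoning
  cancel : ∀ m → + 1 ℤ.+ m ℤ.- + 1 ≡ m
  cancel = solve-∀
... | Bézout.-+ x y 1+xd≡yd' = ℤ.- + x , ∣⇒≡-mod (ℤ.- + x ℤ.* + d) (+ 1) (ℤ∣.divides (ℤ.- + y) (begin
  ℤ.- + x ℤ.* + d ℤ.- + 1      ≡⟨ negate (+ x) (+ d) ⟩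
  ℤ.- (+ 1 ℤ.+ + x ℤ.* + d)    ≡⟨ cong (λ m → ℤ.- (+ 1 ℤ.+ m)) (ℤP.pos-* x d) ⟨
  ℤ.- (+ 1 ℤ.+ + (x * d))      ≡⟨ cong ℤ.-_ (ℤP.pos-+ 1 (x * d)) ⟨
  ℤ.- + (1 + x * d)            ≡⟨ cong (λ m → ℤ.- + m) 1+xd≡yd' ⟩
  ℤ.- + (y * d')               ≡⟨ cong ℤ.-_ (ℤP.pos-* y d') ⟩
  ℤ.- (+ y ℤ.* + d')           ≡⟨ ℤP.neg-distribˡ-* (+ y) (+ d') ⟩
  ℤ.- + y ℤ.* + d'             ∎))
  where
  open ≡-Reasoning
  negate : ∀ x d → ℤ.- x ℤ.* d ℤ.- + 1 ≡ ℤ.- (+ 1 ℤ.+ x ℤ.* d)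
  negate = solve-∀

coprime⇒*-∣ : ∀ {z} → Coprime d d' → d ∣ℕ z → d' ∣ℕ z → d * d' ∣ℕ z
coprime⇒*-∣ {d} {d'} {z} c d∣z d'∣z =
  coprime-factors c (ℕ∣.*-monoʳ-∣ d d'∣z , subst (_∣ℕ d' * z) (*-comm d' d) (ℕ∣.*-monoʳ-∣ d' d∣z))

module CRT (coprime : Coprime d d') (α β : ℤ) where

  private
    u = proj₁ (coprime⇒inverse coprime)
    ud≡1 = proj₂ (coprime⇒inverse coprime)

  solution : ℤ
  solution = α ℤ.+ u ℤ.* + d ℤ.* (β ℤ.- α)

  solution≡α : solution ≡ α [mod d ]
  solution≡α = ∣⇒≡-mod solution α (ℤ∣.divides (u ℤ.* (β ℤ.- α)) (shift α β u (+ d)))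
    where
    shift : ∀ α β u d → (α ℤ.+ u ℤ.* d ℤ.* (β ℤ.- α)) ℤ.- α ≡ (u ℤ.* (β ℤ.- α)) ℤ.* d
    shift = solve-∀

  solution≡β : solution ≡ β [mod d' ]
  solution≡β = ∣⇒≡-mod solution β (subst (+ d' ℤ∣.∣_) (shift α β (u ℤ.* + d))
    (ℤ∣.∣m⇒∣m*n (β ℤ.- α) (≡-mod⇒∣ (u ℤ.* + d) (+ 1) ud≡1)))
    where
    shift : ∀ α β v → (v ℤ.- + 1) ℤ.* (β ℤ.- α) ≡ (α ℤ.+ v ℤ.* (β ℤ.- α)) ℤ.- β
    shift = solve-∀

  ≡-mod-*⇔ : ∀ x → x ≡ solution [mod d * d' ] ⇔ (x ≡ α [mod d ] × x ≡ β [mod d' ])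
  ≡-mod-*⇔ x = mk⇔
    (λ x≡s → ≡-mod-trans x solution α (∣-trans (m∣m*n d') x≡s) solution≡α
           , ≡-mod-trans x solution β (∣-trans (n∣m*n d) x≡s) solution≡β)
    (λ (x≡α , x≡β) → coprime⇒*-∣ coprime
      (≡-mod-trans x α solution x≡α (≡-mod-sym solution α solution≡α))
      (≡-mod-trans x β solution x≡β (≡-mod-sym solution β solution≡β)))

crt : Coprime d d' → ∀ α β → ∃ λ y → y ≡ α [mod d ] × y ≡ β [mod d' ]
crt coprime α β = solution , solution≡α , solution≡β
  where open CRT coprime α β

≡-mod⇒overlap-* : ∀ {a a' c c'} m → Coprime c c' → a ≡ a' [mod m ] → Overlap a (m * c) a' (m * c')
-- `let` rather than `with`: abstracting over the CRT solution would normalise it, and with it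
-- Bézout's algorithm.
≡-mod⇒overlap-* {a} {a'} {c} {c'} m coprime a≡a' =
  let ℤ∣.divides t a-a'≡tm = ≡-mod⇒∣ a a' a≡a'
      y , y≡0 , y≡-t = crt coprime (+ 0) (ℤ.- t)
  in a ℤ.+ y ℤ.* + m ,
     ∣⇒≡-mod (a ℤ.+ y ℤ.* + m) a (scale c (x-a a y (+ m)) (≡-mod⇒∣ y (+ 0) y≡0)) ,
     ∣⇒≡-mod (a ℤ.+ y ℤ.* + m) a' (scale c' (x-a' a a' y (+ m) t a-a'≡tm) (≡-mod⇒∣ y (ℤ.- t) y≡-t))
  where
  scale : ∀ {z w} c → + m ℤ.* w ≡ z → + c ℤ∣.∣ w → + (m * c) ℤ∣.∣ z
  scale c eq c∣w = subst₂ ℤ∣._∣_ (sym (ℤP.pos-* m c)) eq (ℤ∣.*-monoʳ-∣ (+ m) c∣w)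
  x-a : ∀ a y m → m ℤ.* (y ℤ.- + 0) ≡ a ℤ.+ y ℤ.* m ℤ.- a
  x-a = solve-∀
  x-a' : ∀ a a' y m t → a ℤ.- a' ≡ t ℤ.* m → m ℤ.* (y ℤ.- ℤ.- t) ≡ a ℤ.+ y ℤ.* m ℤ.- a'
  x-a' a a' y m t a-a'≡tm = begin
    m ℤ.* (y ℤ.- ℤ.- t)     ≡⟨ ring₁ m y t ⟩
    t ℤ.* m ℤ.+ y ℤ.* m     ≡⟨ cong (ℤ._+ y ℤ.* m) a-a'≡tm ⟨
    a ℤ.- a' ℤ.+ y ℤ.* m    ≡⟨ ring₂ a a' y m ⟩
    a ℤ.+ y ℤ.* m ℤ.- a'    ∎
    where
    open ≡-Reasoning
    ring₁ : ∀ m y t → m ℤ.* (y ℤ.- ℤ.- t) ≡ t ℤ.* m ℤ.+ y ℤ.* m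
    ring₁ = solve-∀
    ring₂ : ∀ a a' y m → a ℤ.- a' ℤ.+ y ℤ.* m ≡ a ℤ.+ y ℤ.* m ℤ.- a'
    ring₂ = solve-∀

-- Which q * p ^ k are non-intersecting

IsCDSet⇒¬overlap : ∀ {n a} → IsCDSet n a → d ∣ℕ n → 1 < d → d' ∣ℕ n → 1 < d' → d ≢ d' →
                   ∀ g → g ∣ℕ d → g ∣ℕ d' → 1 < g → ¬ Overlap (a d) d (a d') d'
IsCDSet⇒¬overlap cd d∣n 1<d d'∣n 1<d' d≢d' g g∣d g∣d' 1<g ov =
  <-irrefl (sym (∣1⇒≡1 (subst (g ∣ℕ_) (cd _ _ d∣n 1<d d'∣n 1<d' d≢d' ov) (gcd-greatest g∣d g∣d')))) 1<g

IsCDSet⇒≢-mod : ∀ {n a m c c'} .{{_ : NonZero c}} .{{_ : NonZero c'}} → IsCDSet n a →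
  1 < m → Coprime c c' → c ≢ c' → m * c ∣ℕ n → m * c' ∣ℕ n → ¬ a (m * c) ≡ a (m * c') [mod m ]
IsCDSet⇒≢-mod {m = m} {c} {c'} cd 1<m coprime c≢c' mc∣n mc'∣n a≡a' =
  IsCDSet⇒¬overlap cd mc∣n (<-≤-trans 1<m (m≤m*n m c)) mc'∣n (<-≤-trans 1<m (m≤m*n m c'))
    (c≢c' ∘ *-cancelˡ-≡ c c' m {{m≢0}}) m (m∣m*n c) (m∣m*n c') 1<m (≡-mod⇒overlap-* m coprime a≡a')
  where m≢0 = ℕ.>-nonZero (<-trans z<s 1<m)

¬nonIntersecting[q*2^[2+k]] : Prime q → q ≢ 2 → ∀ k → ¬ NonIntersecting (q * 2 ^ (2 + k))
¬nonIntersecting[q*2^[2+k]] {q} pq q≢2 k (a , cd) = clash (residues-mod-2 (a 2) (a 4) (a (2 * q)))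
  where
  instance _ = prime⇒nonZero pq
  1<2 : 1 < 2
  1<2 = s≤s z<s
  2<q : 2 < q
  2<q = ≤∧≢⇒< (prime⇒1< pq) (q≢2 ∘ sym)
  2∣n : 2 ∣ℕ q * 2 ^ (2 + k)
  2∣n = ∣n⇒∣m*n q (m∣m*n (2 ^ suc k))
  4∣n : 4 ∣ℕ q * 2 ^ (2 + k)
  4∣n = ∣n⇒∣m*n q (ℕ∣.*-monoʳ-∣ 2 (m∣m*n {2} (2 ^ k)))
  2q∣n : 2 * q ∣ℕ q * 2 ^ (2 + k)
  2q∣n = divides (2 * 2 ^ k) (rearrange q (2 ^ k))
    where
    rearrange : ∀ q m → q * (2 * (2 * m)) ≡ 2 * m * (2 * q)
    rearrange = ℕS.solve-∀
  clash : a 2 ≡ a 4 [mod 2 ] ⊎ a 2 ≡ a (2 * q) [mod 2 ] ⊎ a 4 ≡ a (2 * q) [mod 2 ] → ⊥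
  clash (inj₁ a₂≡a₄)        = IsCDSet⇒≢-mod cd 1<2 (1-coprimeTo 2) (λ ()) 2∣n 4∣n a₂≡a₄
  clash (inj₂ (inj₁ a₂≡a₂q)) = IsCDSet⇒≢-mod cd 1<2 (1-coprimeTo q) (<⇒≢ (prime⇒1< pq)) 2∣n 2q∣n a₂≡a₂q
  clash (inj₂ (inj₂ a₄≡a₂q)) =
    IsCDSet⇒≢-mod cd 1<2 (coprime-sym (prime⇒coprime pq 2<q)) (<⇒≢ 2<q) 4∣n 2q∣n a₄≡a₂q

nonIntersecting⇒k≡1⊎2<p : Prime p → Prime q → p ≢ q → 1 ≤ k → NonIntersecting (q * p ^ k) →
                           k ≡ 1 ⊎ 2 < p
nonIntersecting⇒k≡1⊎2<p {p} {q} {k} pp pq p≢q 1≤k ni with 2 <? p | k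
... | yes 2<p | _       = inj₂ 2<p
... | no 2≮p  | 1       = inj₁ refl
... | no 2≮p  | 2+ k'   = ⊥-elim (¬nonIntersecting[q*2^[2+k]] pq (p≢q ∘ trans p≡2 ∘ sym) k'
                                    (subst (λ p → NonIntersecting (q * p ^ (2 + k'))) p≡2 ni))
  where
  p≡2 : p ≡ 2
  p≡2 = ≤-antisym (≮⇒≥ 2≮p) (prime⇒1< pp)

-- a_q = 0 because q / p < q.
cdResidue : (p q : ℕ) → .{{NonZero p}} → .{{NonZero q}} → ℕ → ℤ
cdResidue p q d with q ∣? d
... | yes _ = + (d / p / q)
... | no _  = + (2 * (d / p))

module CDConstruction {p q k : ℕ} (pp : Prime p) (pq : Prime q) (p≢q : p ≢ q)
                      (k≡1⊎2<p : k ≡ 1 ⊎ 2 < p) where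

  private
    instance
      p≢0 = prime⇒nonZero pp
      q≢0 = prime⇒nonZero pq
    1<p = prime⇒1< pp

  residue-p^[1+j] : ∀ j → cdResidue p q (p ^ suc j) ≡ + (2 * p ^ j)
  residue-p^[1+j] j with q ∣? p ^ suc j
  ... | yes q∣p^[1+j] = ⊥-elim (prime∤p^i pp pq p≢q (suc j) q∣p^[1+j])
  ... | no _ = cong (λ m → + (2 * m)) (trans (cong (ℕ._/ p) (*-comm p (p ^ j))) (m*n/n≡m (p ^ j) p))

  residue-q : cdResidue p q q ≡ + 0
  residue-q with q ∣? q
  ... | yes _ = cong +_ (m<n⇒m/n≡0 (m/n<m q p 1<p))
  ... | no q∤q = ⊥-elim (q∤q ∣-refl)

  residue-qp^[1+i] : ∀ i → cdResidue p q (q * p ^ suc i) ≡ + (1 * p ^ i)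
  residue-qp^[1+i] i with q ∣? q * p ^ suc i
  ... | no q∤ = ⊥-elim (q∤ (m∣m*n (p ^ suc i)))
  ... | yes _ = cong +_ (begin
    q * (p * p ^ i) / p / q   ≡⟨ cong (λ m → m / p / q) (rearrange q p (p ^ i)) ⟩
    p ^ i * q * p / p / q     ≡⟨ cong (ℕ._/ q) (m*n/n≡m (p ^ i * q) p) ⟩
    p ^ i * q / q               ≡⟨ m*n/n≡m (p ^ i) q ⟩
    p ^ i                         ≡⟨ *-identityˡ (p ^ i) ⟨
    1 * p ^ i                     ∎)
    where
    open ≡-Reasoning
    rearrange : ∀ q p m → q * (p * m) ≡ m * q * p
    rearrange = ℕS.solve-∀

  private
    variable
      i i' j j' u v : ℕ

    ¬p∣2 : i < j → j < k → ¬ p ∣ℕ 2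
    ¬p∣2 i<j j<k p∣2 = [ (λ k≡1 → n≮0 (<-≤-trans i<j (ℕ.s≤s⁻¹ (subst (_ <_) k≡1 j<k))))
                       , (λ 2<p → <⇒≱ 2<p (ℕ∣.∣⇒≤ p∣2)) ]′ k≡1⊎2<p

    ¬p∣1 : ¬ p ∣ℕ 1
    ¬p∣1 p∣1 = <-irrefl (sym (∣1⇒≡1 p∣1)) 1<p

    valuations-differ : ∀ u v → i < j → (+ (u * p ^ i)) ≡ (+ (v * p ^ j)) [mod p ^ suc i ] → p ∣ℕ u
    valuations-differ {i} {j} u v i<j u≡v =
      p^[1+i]∣u*p^i⇒p∣u i (≡-mod-∣ (u * p ^ i) (v * p ^ j) u≡v (∣n⇒∣m*n v (^-monoʳ-∣ p i<j)))

  private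
    a = cdResidue p q

  disjoint-P-P : j < j' → j' < k → ¬ Overlap (a (p ^ suc j)) (p ^ suc j) (a (p ^ suc j')) (p ^ suc j')
  disjoint-P-P {j} {j'} j<j' j'<k ov = ¬p∣2 j<j' j'<k (valuations-differ 2 2 j<j'
    (overlap⇒≡-mod _ _ (p ^ suc j) (overlap-cong (residue-p^[1+j] j) (residue-p^[1+j] j') ov)
      ∣-refl (^-monoʳ-∣ p (s≤s (<⇒≤ j<j')))))

  disjoint-R-R : i < i' →
    ¬ Overlap (a (q * p ^ suc i)) (q * p ^ suc i) (a (q * p ^ suc i')) (q * p ^ suc i')
  disjoint-R-R {i} {i'} i<i' ov = ¬p∣1 (valuations-differ 1 1 i<i'
    (overlap⇒≡-mod _ _ (p ^ suc i) (overlap-cong (residue-qp^[1+i] i) (residue-qp^[1+i] i') ov)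
      (∣n⇒∣m*n q ∣-refl) (∣n⇒∣m*n q (^-monoʳ-∣ p (s≤s (<⇒≤ i<i'))))))

  disjoint-P-R : ∀ j → i < k → ¬ Overlap (a (p ^ suc j)) (p ^ suc j) (a (q * p ^ suc i)) (q * p ^ suc i)
  disjoint-P-R {i} j i<k ov′ with <-cmp j i
  ... | tri< j<i _ _ = ¬p∣2 j<i i<k (valuations-differ 2 1 j<i
    (overlap⇒≡-mod _ _ (p ^ suc j) ov ∣-refl (∣n⇒∣m*n q (^-monoʳ-∣ p (s≤s (<⇒≤ j<i))))))
    where ov = overlap-cong (residue-p^[1+j] j) (residue-qp^[1+i] i) ov′
  ... | tri≈ _ refl _ = p^[1+i]∤p^i 1<p j (≡-mod-+ˡ⇒∣ {x = p ^ j} {y = 1 * p ^ j}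
    (overlap⇒≡-mod _ _ (p ^ suc j) ov ∣-refl (∣n⇒∣m*n q ∣-refl)))
    where ov = overlap-cong (residue-p^[1+j] j) (residue-qp^[1+i] i) ov′
  ... | tri> _ _ i<j = ¬p∣1 (valuations-differ 1 2 i<j
    (overlap⇒≡-mod _ _ (p ^ suc i) (overlap-sym ov) (∣n⇒∣m*n q ∣-refl) (^-monoʳ-∣ p (s≤s (<⇒≤ i<j)))))
    where ov = overlap-cong (residue-p^[1+j] j) (residue-qp^[1+i] i) ov′

  disjoint-Q-R : ∀ i → ¬ Overlap (a q) q (a (q * p ^ suc i)) (q * p ^ suc i)
  disjoint-Q-R i ov′ = prime∤p^i pp pq p≢q i (subst (q ∣ℕ_) (*-identityˡ (p ^ i))
    (≡-mod-∣ (1 * p ^ i) 0 (≡-mod-sym (+ 0) (+ (1 * p ^ i)) 0≡p^i) (q ∣0)))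
    where
    ov = overlap-cong residue-q (residue-qp^[1+i] i) ov′
    0≡p^i = overlap⇒≡-mod (+ 0) (+ (1 * p ^ i)) q ov ∣-refl (m∣m*n (p ^ suc i))

  coprime-P-Q : ∀ j → gcd (p ^ suc j) q ≡ 1
  coprime-P-Q j = coprime⇒gcd≡1 (prime∤⇒coprime pq (prime∤p^i pp pq p≢q (suc j)))

  cdResidue-isCD : IsCDSet (q * p ^ k) a
  cdResidue-isCD d d' d∣n 1<d d'∣n 1<d' d≢d' ov
    with classifyDivisor pp pq k d∣n 1<d | classifyDivisor pp pq k d'∣n 1<d'
  ... | pPower j j<k refl | pPower j' j'<k refl with <-cmp j j'
  ...   | tri< j<j' _ _ = ⊥-elim (disjoint-P-P j<j' j'<k ov)
  ...   | tri≈ _ refl _ = ⊥-elim (d≢d' refl)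
  ...   | tri> _ _ j'<j = ⊥-elim (disjoint-P-P j'<j j<k (overlap-sym ov))
  cdResidue-isCD _ _ _ _ _ _ _ _ | pPower j _ refl | qItself refl = coprime-P-Q j
  cdResidue-isCD _ _ _ _ _ _ _ ov | pPower j _ refl | qTimesPPower i i<k refl =
    ⊥-elim (disjoint-P-R j i<k ov)
  cdResidue-isCD _ _ _ _ _ _ _ _ | qItself refl | pPower j _ refl = trans (gcd-comm q _) (coprime-P-Q j)
  cdResidue-isCD _ _ _ _ _ _ d≢d' _ | qItself refl | qItself refl = ⊥-elim (d≢d' refl)
  cdResidue-isCD _ _ _ _ _ _ _ ov | qItself refl | qTimesPPower i _ refl = ⊥-elim (disjoint-Q-R i ov)
  cdResidue-isCD _ _ _ _ _ _ _ ov | qTimesPPower i i<k refl | pPower j _ refl =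
    ⊥-elim (disjoint-P-R j i<k (overlap-sym ov))
  cdResidue-isCD _ _ _ _ _ _ _ ov | qTimesPPower i _ refl | qItself refl =
    ⊥-elim (disjoint-Q-R i (overlap-sym ov))
  cdResidue-isCD _ _ _ _ _ _ d≢d' ov | qTimesPPower i _ refl | qTimesPPower i' _ refl
    with <-cmp i i'
  ... | tri< i<i' _ _ = ⊥-elim (disjoint-R-R i<i' ov)
  ... | tri≈ _ refl _ = ⊥-elim (d≢d' refl)
  ... | tri> _ _ i'<i = ⊥-elim (disjoint-R-R i'<i (overlap-sym ov))

-- Finite sums

∑< : ℕ → (ℕ → ℕ) → ℕ
∑< zero    f = 0
∑< (suc N) f = f 0 + ∑< N (f ∘ suc)

syntax ∑< N (λ i → e) = ∑[ i < N ] e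

𝟙 : Dec A → ℕ
𝟙 (yes _) = 1
𝟙 (no _)  = 0

∑-cong : (∀ i → i < N → f i ≡ g i) → ∑< N f ≡ ∑< N g
∑-cong {zero}  f≡g = refl
∑-cong {suc N} f≡g = cong₂ _+_ (f≡g 0 z<s) (∑-cong (λ i i<N → f≡g (suc i) (s≤s i<N)))

∑-distrib-+ : ∀ f g N → ∑[ i < N ] (f i + g i) ≡ ∑< N f + ∑< N g
∑-distrib-+ f g zero    = refl
∑-distrib-+ f g (suc N) =
  trans (cong (_+_ (f 0 + g 0)) (∑-distrib-+ (f ∘ suc) (g ∘ suc) N)) (interchange (f 0) (g 0) _ _)
  where
  interchange : ∀ a b c d → a + b + (c + d) ≡ a + c + (b + d)
  interchange = ℕS.solve-∀

∑-distribˡ-* : ∀ c N → ∑[ i < N ] (c * f i) ≡ c * ∑< N f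
∑-distribˡ-* c zero    = sym (*-zeroʳ c)
∑-distribˡ-* {f} c (suc N) =
  trans (cong (_+_ (c * f 0)) (∑-distribˡ-* c N)) (sym (*-distribˡ-+ c (f 0) _))

∑-distribʳ-* : ∀ c N → ∑[ i < N ] (f i * c) ≡ ∑< N f * c
∑-distribʳ-* {f} c N = begin
  ∑[ i < N ] (f i * c) ≡⟨ ∑-cong {N} (λ i _ → *-comm (f i) c) ⟩
  ∑[ i < N ] (c * f i) ≡⟨ ∑-distribˡ-* c N ⟩
  c * ∑< N f           ≡⟨ *-comm c _ ⟩
  ∑< N f * c           ∎
  where open ≡-Reasoning

∑-zero : ∀ N → ∑[ i < N ] 0 ≡ 0
∑-zero zero    = refl
∑-zero (suc N) = ∑-zero N

∑-++ : ∀ M N → ∑< (M + N) f ≡ ∑< M f + ∑[ i < N ] f (M + i)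
∑-++ zero    N = refl
∑-++ {f} (suc M) N = trans (cong (_+_ (f 0)) (∑-++ M N)) (sym (+-assoc (f 0) _ _))

∑-snoc : ∀ N → ∑< (suc N) f ≡ ∑< N f + f N
∑-snoc     zero    = +-comm _ 0
∑-snoc {f} (suc N) = trans (cong (_+_ (f 0)) (∑-snoc N)) (sym (+-assoc (f 0) _ _))

∑-comm : ∀ (h : ℕ → ℕ → ℕ) M N → ∑[ i < M ] ∑[ j < N ] h i j ≡ ∑[ j < N ] ∑[ i < M ] h i j
∑-comm h zero    N = sym (∑-zero N)
∑-comm h (suc M) N = trans (cong (_+_ (∑< N (h 0))) (∑-comm (h ∘ suc) M N))
  (sym (∑-distrib-+ (h 0) _ N))

∑-≤ : ∀ N → (∀ i → f i ≤ 1) → ∑< N f ≤ N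
∑-≤ zero    f≤1 = z≤n
∑-≤ (suc N) f≤1 = +-mono-≤ (f≤1 0) (∑-≤ N (f≤1 ∘ suc))

module _ (h : ℕ → ℕ) (n : ℕ) (periodic : ∀ x → h (x + n) ≡ h x) where

  ∑-shift : ∀ s → ∑[ i < n ] h (s + i) ≡ ∑< n h
  ∑-shift zero    = refl
  ∑-shift (suc s) = trans (+-cancelʳ-≡ (h s) _ _ (begin
    ∑[ i < n ] h (suc s + i) + h s      ≡⟨ +-comm _ (h s) ⟩
    h s + ∑[ i < n ] h (suc s + i)      ≡⟨ cong₂ _+_ (cong h (+-identityʳ s))
                                                   (∑-cong {n} (λ i _ → cong h (+-suc s i))) ⟨
    ∑[ i < suc n ] h (s + i)            ≡⟨ ∑-snoc n ⟩
    ∑[ i < n ] h (s + i) + h (s + n)    ≡⟨ cong (_+_ (∑[ i < n ] h (s + i))) (periodic s) ⟩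
    ∑[ i < n ] h (s + i) + h s          ∎))
    (∑-shift s)
    where open ≡-Reasoning

  ∑-blocks : ∀ m s → ∑[ i < m * n ] h (s + i) ≡ m * ∑< n h
  ∑-blocks zero    s = refl
  ∑-blocks (suc m) s = begin
    ∑[ i < n + m * n ] h (s + i)
      ≡⟨ ∑-++ n (m * n) ⟩
    ∑[ i < n ] h (s + i) + ∑[ i < m * n ] h (s + (n + i))
      ≡⟨ cong₂ _+_ (∑-shift s) (∑-cong {m * n} (λ i _ → cong h (sym (+-assoc s n i)))) ⟩
    ∑< n h + ∑[ i < m * n ] h (s + n + i)
      ≡⟨ cong (_+_ (∑< n h)) (∑-blocks m (s + n)) ⟩
    ∑< n h + m * ∑< n h
      ∎
    where open ≡-Reasoning

𝟙≤1 : (A? : Dec A) → 𝟙 A? ≤ 1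
𝟙≤1 (yes _) = s≤s z≤n
𝟙≤1 (no _)  = z≤n

𝟙-yes : (A? : Dec A) → A → 𝟙 A? ≡ 1
𝟙-yes (yes _) _ = refl
𝟙-yes (no ¬a) a = contradiction a ¬a

𝟙-no : (A? : Dec A) → ¬ A → 𝟙 A? ≡ 0
𝟙-no (yes a) ¬a = contradiction a ¬a
𝟙-no (no _)  _  = refl

𝟙-cong : A ⇔ B → (A? : Dec A) (B? : Dec B) → 𝟙 A? ≡ 𝟙 B?
𝟙-cong A⇔B (yes a) B? = sym (𝟙-yes B? (Equivalence.to A⇔B a))
𝟙-cong A⇔B (no ¬a) B? = sym (𝟙-no B? (¬a ∘ Equivalence.from A⇔B))

𝟙-× : (A? : Dec A) (B? : Dec B) → 𝟙 A? * 𝟙 B? ≡ 𝟙 (A? ×-dec B?)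
𝟙-× (yes _) (yes _) = refl
𝟙-× (yes _) (no _)  = refl
𝟙-× (no _)  _       = refl

∑𝟙≡0 : ∀ {P : Pred ℕ ℓ} (P? : Decidable P) N → (∀ i → i < N → ¬ P i) → ∑[ i < N ] 𝟙 (P? i) ≡ 0
∑𝟙≡0 P? N ¬P = trans (∑-cong {N} (λ i i<N → 𝟙-no (P? i) (¬P i i<N))) (∑-zero N)

∑𝟙≡1 : ∀ {P : Pred ℕ ℓ} (P? : Decidable P) N {i} → i < N → P i → (∀ j → j < N → P j → j ≡ i) →
       ∑[ j < N ] 𝟙 (P? j) ≡ 1
∑𝟙≡1 P? (suc N) {zero} _ Pi unique = cong₂ _+_ (𝟙-yes (P? 0) Pi)
  (∑𝟙≡0 (P? ∘ suc) N (λ j j<N Pj → 0≢1+n (sym (unique (suc j) (s≤s j<N) Pj))))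
∑𝟙≡1 P? (suc N) {suc i} (s≤s i<N) Pi unique =
  cong₂ _+_ (𝟙-no (P? 0) (λ P0 → 0≢1+n (unique 0 z<s P0)))
  (∑𝟙≡1 (P? ∘ suc) N i<N Pi (λ j j<N Pj → suc-injective (unique (suc j) (s≤s j<N) Pj)))

length-filter≡∑𝟙 : ∀ {P : Pred ℕ ℓ} (P? : Decidable P) N →
               length (filter P? (map suc (upTo N))) ≡ ∑[ i < N ] 𝟙 (P? (suc i))
length-filter≡∑𝟙 P? N = trans (cong (length ∘ filter P?) (map-upTo suc N)) (go suc N)
  where
  go : ∀ g N → length (filter P? (applyUpTo g N)) ≡ ∑[ i < N ] 𝟙 (P? (g i))
  go g zero = refl
  go g (suc N) with P? (g 0)
  ... | yes _ = cong suc (go (g ∘ suc) N)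
  ... | no _  = go (g ∘ suc) N

-- Densities

toℚᵘ-÷ℕ : ∀ a b → ℚ.toℚᵘ (a ÷ℕ suc b) ℚᵘ.≃ mkℚᵘ (+ a) b
toℚᵘ-÷ℕ a b = ℚP.toℚᵘ-fromℚᵘ (mkℚᵘ (+ a) b)

÷ℕ-cong : ∀ a b c d .{{_ : NonZero b}} .{{_ : NonZero d}} → a * d ≡ c * b → a ÷ℕ b ≡ c ÷ℕ d
÷ℕ-cong a (suc b) c (suc d) ad≡cb = ℚP.toℚᵘ-injective (ℚᵘP.≃-trans (toℚᵘ-÷ℕ a b)
  (ℚᵘP.≃-trans (*≡* (trans (sym (ℤP.pos-* a (suc d))) (trans (cong +_ ad≡cb) (ℤP.pos-* c (suc b)))))
    (ℚᵘP.≃-sym (toℚᵘ-÷ℕ c d))))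

÷ℕ-+-÷ℕ : ∀ a b c d .{{_ : NonZero b}} .{{_ : NonZero d}} →
          a ÷ℕ b ℚ.+ c ÷ℕ d ≡ (a * d + c * b) ÷ℕ (b * d)
÷ℕ-+-÷ℕ a (suc b) c (suc d) = ℚP.toℚᵘ-injective (ℚᵘP.≃-trans (ℚP.toℚᵘ-homo-+ (a ÷ℕ suc b) (c ÷ℕ suc d))
  (ℚᵘP.≃-trans (ℚᵘP.+-cong (toℚᵘ-÷ℕ a b) (toℚᵘ-÷ℕ c d))
    (ℚᵘP.≃-trans (ℚᵘP.≃-reflexive (cong (λ z → mkℚᵘ z _) numerator))
      (ℚᵘP.≃-sym (toℚᵘ-÷ℕ (a * suc d + c * suc b) _)))))
  where
  numerator : + a ℤ.* + suc d ℤ.+ + c ℤ.* + suc b ≡ + (a * suc d + c * suc b)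
  numerator = trans (cong₂ ℤ._+_ (sym (ℤP.pos-* a (suc d))) (sym (ℤP.pos-* c (suc b))))
    (sym (ℤP.pos-+ (a * suc d) (c * suc b)))

∣m⊖n∣≡∣m-n∣ : ∀ m n → ℤ.∣ m ℤ.⊖ n ∣ ≡ ∣ m - n ∣
∣m⊖n∣≡∣m-n∣ zero    zero    = refl
∣m⊖n∣≡∣m-n∣ zero    (suc n) = refl
∣m⊖n∣≡∣m-n∣ (suc m) zero    = refl
∣m⊖n∣≡∣m-n∣ (suc m) (suc n) = trans (cong ℤ.∣_∣ (ℤP.[1+m]⊖[1+n]≡m⊖n m n)) (∣m⊖n∣≡∣m-n∣ m n)

HasDensity-cong : ∀ {F G : ℕ → ℕ} {r} → (∀ N → F N ≡ G N) → HasDensity F r → HasDensity G r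
HasDensity-cong {r = r} F≡G dens ε ε>0 with dens ε ε>0
... | N₀ , close = N₀ , λ N N₀≤N N≢0 →
  subst (λ v → ℚ.∣ (v ÷ℕ N) ℚ.- r ∣ ℚ.< ε) (F≡G N) (close N N₀≤N N≢0)

distance-bound⇒density : ∀ (F : ℕ → ℕ) n' C →
  (∀ N → ∣ F N * suc n' - N * C ∣ ≤ suc n' * suc n') → HasDensity F (C ÷ℕ suc n')
distance-bound⇒density F n' C bound (mkℚ (+ 0) _ _) (ℚ.*<* (ℤ.+<+ ()))
distance-bound⇒density F n' C bound (mkℚ ℤ.-[1+ _ ] _ _) (ℚ.*<* ())
-- Beyond N₀ = n (b + 1) + 1 the error n² / (N n) is below 1 / (b + 1) ≤ ε.
distance-bound⇒density F n' C bound (mkℚ +[1+ a ] b _) _ = suc (n * suc b) , close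
  where
  n = suc n'
  close : ∀ N → suc (n * suc b) ≤ N → N ≢ 0 →
          ℚ.∣ (F N ÷ℕ N) ℚ.- (C ÷ℕ n) ∣ ℚ.< mkℚ +[1+ a ] b _
  close zero     _        0≢0 = ⊥-elim (0≢0 refl)
  close N@(suc N') N₀≤N _ =
    ℚP.toℚᵘ-cancel-< (ℚᵘP.<-respˡ-≃ (ℚᵘP.≃-sym distance)
      (*<* (subst₂ ℤ._<_ lhs rhs (ℤ.+<+ gap*[1+b]<[1+a]*N*n))))
    where
    x = F N ÷ℕ N
    y = C ÷ℕ n
    distance : ℚ.toℚᵘ (ℚ.∣ x ℚ.- y ∣) ℚᵘ.≃ ℚᵘ.∣ mkℚᵘ (+ F N) N' ℚᵘ.- mkℚᵘ (+ C) n' ∣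
    distance = ℚᵘP.≃-trans (ℚP.toℚᵘ-homo-∣-∣ (x ℚ.- y))
      (ℚᵘP.∣-∣-cong (ℚᵘP.≃-trans (ℚP.toℚᵘ-homo-+ x (ℚ.- y))
        (ℚᵘP.+-cong (ℚP.toℚᵘ-fromℚᵘ (mkℚᵘ (+ F N) N'))
          (ℚᵘP.≃-trans (ℚP.toℚᵘ-homo‿- y) (ℚᵘP.-‿cong (ℚP.toℚᵘ-fromℚᵘ (mkℚᵘ (+ C) n')))))))
    gap≡ : ℤ.∣ + F N ℤ.* + n ℤ.+ ℤ.- (+ C) ℤ.* + N ∣ ≡ ∣ F N * n - N * C ∣
    gap≡ = trans (cong ℤ.∣_∣ (begin
      + F N ℤ.* + n ℤ.+ ℤ.- (+ C) ℤ.* + N ≡⟨ reorder (+ F N) (+ n) (+ C) (+ N) ⟩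
      + F N ℤ.* + n ℤ.- + N ℤ.* + C       ≡⟨ cong₂ ℤ._-_ (ℤP.pos-* (F N) n) (ℤP.pos-* N C) ⟨
      + (F N * n) ℤ.- + (N * C)            ≡⟨ ℤP.m-n≡m⊖n (F N * n) (N * C) ⟩
      (F N * n) ℤ.⊖ (N * C)                ∎))
      (∣m⊖n∣≡∣m-n∣ (F N * n) (N * C))
      where
      open ≡-Reasoning
      reorder : ∀ f n c N → f ℤ.* n ℤ.+ ℤ.- c ℤ.* N ≡ f ℤ.* n ℤ.- N ℤ.* c
      reorder = solve-∀
    gap*[1+b]<[1+a]*N*n : ∣ F N * n - N * C ∣ * suc b < suc a * (N * n)
    gap*[1+b]<[1+a]*N*n = begin-strict
      ∣ F N * n - N * C ∣ * suc b ≤⟨ *-monoˡ-≤ (suc b) (bound N) ⟩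
      n * n * suc b              ≡⟨ *-assoc n n (suc b) ⟩
      n * (n * suc b)            <⟨ *-monoʳ-< n N₀≤N ⟩
      n * N                      ≡⟨ *-comm n N ⟩
      N * n                      ≤⟨ m≤n*m (N * n) (suc a) ⟩
      suc a * (N * n)            ∎
      where open ≤-Reasoning
    lhs : + (∣ F N * n - N * C ∣ * suc b) ≡ + ℤ.∣ + F N ℤ.* + n ℤ.+ ℤ.- (+ C) ℤ.* + N ∣ ℤ.* + suc b
    lhs = trans (ℤP.pos-* ∣ F N * n - N * C ∣ (suc b)) (cong (λ g → + g ℤ.* + suc b) (sym gap≡))
    rhs : + (suc a * (N * n)) ≡ +[1+ a ] ℤ.* + (N * n)
    rhs = ℤP.pos-* (suc a) (N * n)

module _ (h : ℕ → ℕ) (n' : ℕ) (h≤1 : ∀ x → h x ≤ 1) (periodic : ∀ x → h (x + suc n') ≡ h x) where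

  private
    n = suc n'
    C = ∑< n h
    F : ℕ → ℕ
    F N = ∑[ i < N ] h (suc i)

  periodic-density : HasDensity F (C ÷ℕ n)
  periodic-density = distance-bound⇒density F n' C distance
    where
    distance : ∀ N → ∣ F N * n - N * C ∣ ≤ n * n
    distance N = begin
      ∣ F N * n - N * C ∣                         ≡⟨ cong₂ (λ u v → ∣ F u * n - v * C ∣) N≡ N≡ ⟩
      ∣ F (m * n + r) * n - (m * n + r) * C ∣     ≡⟨ cong (λ u → ∣ u * n - (m * n + r) * C ∣) F[mn+r]≡ ⟩
      ∣ (m * C + e) * n - (m * n + r) * C ∣       ≡⟨ cong₂ ∣_-_∣ (expand₁ m C e n) (expand₂ m n r C) ⟩
      ∣ m * n * C + e * n - m * n * C + r * C ∣   ≡⟨ ∣m+n-m+o∣≡∣n-o∣ (m * n * C) (e * n) (r * C) ⟩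
      ∣ e * n - r * C ∣                           ≤⟨ ∣m-n∣≤m⊔n (e * n) (r * C) ⟩
      e * n ℕ.⊔ r * C                             ≤⟨ ⊔-lub (*-monoˡ-≤ n (≤-trans e≤r r≤n))
                                                           (*-mono-≤ r≤n (∑-≤ n h≤1)) ⟩
      n * n                                       ∎
      where
      open ≤-Reasoning
      m = N / n
      r = N % n
      r≤n : r ≤ n
      r≤n = <⇒≤ (m%n<n N n)
      N≡ : N ≡ m * n + r
      N≡ = trans (m≡m%n+[m/n]*n N n) (+-comm r (m * n))
      e = ∑[ i < r ] h (suc (m * n + i))
      e≤r : e ≤ r
      e≤r = ∑-≤ r (λ i → h≤1 _)
      F[mn+r]≡ : F (m * n + r) ≡ m * C + e
      F[mn+r]≡ = trans (∑-++ (m * n) r) (cong (_+ e) (∑-blocks h n periodic m 1))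
      expand₁ : ∀ m C e n → (m * C + e) * n ≡ m * n * C + e * n
      expand₁ = ℕS.solve-∀
      expand₂ : ∀ m n r C → (m * n + r) * C ≡ m * n * C + r * C
      expand₂ = ℕS.solve-∀

-- The density of a CD congruence set of q * p ^ k

count-residue : ∀ m d α .{{_ : NonZero d}} → ∑[ x < m * d ] 𝟙 (≡-mod? (+ x) α d) ≡ m
count-residue m d α = begin
  ∑[ x < m * d ] h x ≡⟨ ∑-blocks h d periodic m 0 ⟩
  m * ∑< d h         ≡⟨ cong (m *_) one-per-period ⟩
  m * 1              ≡⟨ *-identityʳ m ⟩
  m                  ∎
  where
  open ≡-Reasoning
  h : ℕ → ℕ
  h x = 𝟙 (≡-mod? (+ x) α d)
  periodic : ∀ x → h (x + d) ≡ h x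
  periodic x = 𝟙-cong (≡-mod-shift x α ∣-refl) (≡-mod? (+ (x + d)) α d) (≡-mod? (+ x) α d)
  one-per-period : ∑< d h ≡ 1
  one-per-period with ≡-mod-representative α d
  ... | r , r<d , r≡α = ∑𝟙≡1 (λ x → ≡-mod? (+ x) α d) d r<d r≡α
    (λ x x<d x≡α → ≡-mod⇒≡ x<d r<d (≡-mod-trans (+ x) α (+ r) x≡α (≡-mod-sym (+ r) α r≡α)))

module CoveredCount {p q k m : ℕ} (pp : Prime p) (pq : Prime q) (p≢q : p ≢ q)
                    (n≡ : q * p ^ k ≡ suc m) (a : ℕ → ℤ) (cd : IsCDSet (suc m) a) where

  private
    n = suc m
    instance
      p≢0 = prime⇒nonZero pp
      q≢0 = prime⇒nonZero pq
    1<p = prime⇒1< pp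
    1<q = prime⇒1< pq

    InP InR : ℕ → ℕ → Set
    InP j x = (+ x) ≡ a (p ^ suc j) [mod p ^ suc j ]
    InR i x = (+ x) ≡ a (q * p ^ suc i) [mod q * p ^ suc i ]
    InQ : ℕ → Set
    InQ x = (+ x) ≡ a q [mod q ]

    inP? : ∀ j x → Dec (InP j x)
    inP? j x = ≡-mod? (+ x) (a (p ^ suc j)) (p ^ suc j)
    inR? : ∀ i x → Dec (InR i x)
    inR? i x = ≡-mod? (+ x) (a (q * p ^ suc i)) (q * p ^ suc i)
    inQ? : ∀ x → Dec (InQ x)
    inQ? x = ≡-mod? (+ x) (a q) q

    P R : ℕ → ℕ → ℕ
    P j x = 𝟙 (inP? j x)
    R i x = 𝟙 (inR? i x)
    Q : ℕ → ℕ
    Q x = 𝟙 (inQ? x)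

    p^[1+j]∣n : ∀ {j} → j < k → p ^ suc j ∣ℕ n
    p^[1+j]∣n {j} j<k = subst (p ^ suc j ∣ℕ_) n≡ (∣n⇒∣m*n q (^-monoʳ-∣ p j<k))
    q∣n : q ∣ℕ n
    q∣n = subst (q ∣ℕ_) n≡ (m∣m*n (p ^ k))
    qp^[1+i]∣n : ∀ {i} → i < k → q * p ^ suc i ∣ℕ n
    qp^[1+i]∣n {i} i<k = subst (q * p ^ suc i ∣ℕ_) n≡ (ℕ∣.*-monoʳ-∣ q (^-monoʳ-∣ p i<k))

    1<p^[1+j] : ∀ j → 1 < p ^ suc j
    1<p^[1+j] j = <-≤-trans 1<p (ℕ∣.∣⇒≤ {{m^n≢0 p (suc j)}} (m∣m*n {p} (p ^ j)))
    q<qp^[1+i] : ∀ i → q < q * p ^ suc i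
    q<qp^[1+i] i = subst (_< q * p ^ suc i) (*-identityʳ q) (*-monoʳ-< q (1<p^[1+j] i))
    1<qp^[1+i] : ∀ i → 1 < q * p ^ suc i
    1<qp^[1+i] i = <-trans 1<q (q<qp^[1+i] i)

    disjoint : ∀ {d d'} g x → d ∣ℕ n → 1 < d → d' ∣ℕ n → 1 < d' → d ≢ d' → g ∣ℕ d → g ∣ℕ d' → 1 < g →
               (+ x) ≡ a d [mod d ] → ¬ (+ x) ≡ a d' [mod d' ]
    disjoint g x d∣n 1<d d'∣n 1<d' d≢d' g∣d g∣d' 1<g x∈d x∈d' =
      IsCDSet⇒¬overlap cd d∣n 1<d d'∣n 1<d' d≢d' g g∣d g∣d' 1<g (+ x , x∈d , x∈d')

    P-unique : ∀ {j j' x} → j < k → j' < k → InP j x → InP j' x → j ≡ j'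
    P-unique {j} {j'} {x} j<k j'<k x∈Pj x∈Pj' with j ℕ.≟ j'
    ... | yes j≡j' = j≡j'
    ... | no j≢j'  = ⊥-elim (disjoint p x
      (p^[1+j]∣n j<k) (1<p^[1+j] j) (p^[1+j]∣n j'<k) (1<p^[1+j] j')
      (j≢j' ∘ suc-injective ∘ ^-injectiveʳ 1<p) (m∣m*n {p} (p ^ j)) (m∣m*n {p} (p ^ j')) 1<p x∈Pj x∈Pj')

    R-unique : ∀ {i i' x} → i < k → i' < k → InR i x → InR i' x → i ≡ i'
    R-unique {i} {i'} {x} i<k i'<k x∈Ri x∈Ri' with i ℕ.≟ i'
    ... | yes i≡i' = i≡i'
    ... | no i≢i'  = ⊥-elim (disjoint q x
      (qp^[1+i]∣n i<k) (1<qp^[1+i] i) (qp^[1+i]∣n i'<k) (1<qp^[1+i] i')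
      (i≢i' ∘ suc-injective ∘ ^-injectiveʳ 1<p ∘ *-cancelˡ-≡ _ _ q)
      (m∣m*n {q} (p ^ suc i)) (m∣m*n {q} (p ^ suc i')) 1<q x∈Ri x∈Ri')

    R⇒¬P : ∀ {i j x} → i < k → j < k → InR i x → ¬ InP j x
    R⇒¬P {i} {j} {x} i<k j<k = disjoint p x (qp^[1+i]∣n i<k) (1<qp^[1+i] i) (p^[1+j]∣n j<k) (1<p^[1+j] j)
      (λ qp^[1+i]≡p^[1+j] →
        prime∤p^i pp pq p≢q (suc j) (subst (q ∣ℕ_) qp^[1+i]≡p^[1+j] (m∣m*n {q} (p ^ suc i))))
      (∣n⇒∣m*n q (m∣m*n {p} (p ^ i))) (m∣m*n {p} (p ^ j)) 1<p

    R⇒¬Q : ∀ {i x} → i < k → InR i x → ¬ InQ x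
    R⇒¬Q {i} {x} i<k = disjoint q x (qp^[1+i]∣n i<k) (1<qp^[1+i] i) q∣n 1<q (<⇒≢ (q<qp^[1+i] i) ∘ sym)
      (m∣m*n {q} (p ^ suc i)) ∣-refl 1<q

    covered⇒ : ∀ {x} → Covered n a (+ x) → (∃ λ j → j < k × InP j x) ⊎ InQ x ⊎ (∃ λ i → i < k × InR i x)
    covered⇒ (d , d∣n , 1<d , x≡a) with classifyDivisor pp pq k (subst (d ∣ℕ_) (sym n≡) d∣n) 1<d
    ... | pPower j j<k refl       = inj₁ (j , j<k , x≡a)
    ... | qItself refl            = inj₂ (inj₁ x≡a)
    ... | qTimesPPower i i<k refl = inj₂ (inj₂ (i , i<k , x≡a))

    covered : ℕ → ℕ
    covered x = 𝟙 (covered? n a (+ x))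

  inclusion-exclusion : ∀ x →
    covered x + ∑[ j < k ] (P j x * Q x) ≡ ∑[ j < k ] P j x + Q x + ∑[ i < k ] R i x
  inclusion-exclusion x rewrite ∑-distribʳ-* {f = λ j → P j x} (Q x) k
    with anyUpTo? (λ i → inR? i x) k | anyUpTo? (λ j → inP? j x) k
  ... | yes (i , i<k , x∈Ri) | _
    rewrite 𝟙-yes (covered? n a (+ x)) (_ , qp^[1+i]∣n i<k , 1<qp^[1+i] i , x∈Ri)
          | ∑𝟙≡0 (λ j → inP? j x) k (λ j j<k → R⇒¬P i<k j<k x∈Ri)
          | 𝟙-no (inQ? x) (R⇒¬Q i<k x∈Ri)
          | ∑𝟙≡1 (λ i → inR? i x) k i<k x∈Ri (λ i' i'<k x∈Ri' → R-unique i'<k i<k x∈Ri' x∈Ri)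
          = refl
  ... | no x∉R | yes (j , j<k , x∈Pj)
    rewrite 𝟙-yes (covered? n a (+ x)) (_ , p^[1+j]∣n j<k , 1<p^[1+j] j , x∈Pj)
          | ∑𝟙≡1 (λ j → inP? j x) k j<k x∈Pj (λ j' j'<k x∈Pj' → P-unique j'<k j<k x∈Pj' x∈Pj)
          | ∑𝟙≡0 (λ i → inR? i x) k (λ i i<k x∈Ri → x∉R (i , i<k , x∈Ri))
          = refl
  ... | no x∉R | no x∉P
    rewrite ∑𝟙≡0 (λ j → inP? j x) k (λ j j<k x∈Pj → x∉P (j , j<k , x∈Pj))
          | ∑𝟙≡0 (λ i → inR? i x) k (λ i i<k x∈Ri → x∉R (i , i<k , x∈Ri))
          = cong (_+ 0)
              (𝟙-cong (mk⇔ covered⇒Q (λ x∈Q → q , q∣n , 1<q , x∈Q)) (covered? n a (+ x)) (inQ? x))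
    where
    covered⇒Q : Covered n a (+ x) → InQ x
    covered⇒Q c with covered⇒ c
    ... | inj₁ x∈P         = ⊥-elim (x∉P x∈P)
    ... | inj₂ (inj₁ x∈Q)  = x∈Q
    ... | inj₂ (inj₂ x∈R)  = ⊥-elim (x∉R x∈R)

  private
    count : ∀ c d α .{{_ : NonZero d}} → c * d ≡ n → ∑[ x < n ] 𝟙 (≡-mod? (+ x) α d) ≡ c
    count c d α cd≡n = subst (λ N → ∑[ x < N ] 𝟙 (≡-mod? (+ x) α d) ≡ c) cd≡n (count-residue c d α)

    p^[k-i]*p^i≡p^k : ∀ {i} → i ≤ k → p ^ (k ∸ i) * p ^ i ≡ p ^ k
    p^[k-i]*p^i≡p^k {i} i≤k = trans (sym (^-distribˡ-+-* p (k ∸ i) i)) (cong (p ^_) (m∸n+n≡m i≤k))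

  count-P : ∀ {j} → j < k → ∑[ x < n ] P j x ≡ q * p ^ (k ∸ suc j)
  count-P {j} j<k = count _ (p ^ suc j) (a (p ^ suc j)) {{m^n≢0 p (suc j)}} (begin
    q * p ^ (k ∸ suc j) * p ^ suc j   ≡⟨ *-assoc q _ _ ⟩
    q * (p ^ (k ∸ suc j) * p ^ suc j) ≡⟨ cong (q *_) (p^[k-i]*p^i≡p^k j<k) ⟩
    q * p ^ k                         ≡⟨ n≡ ⟩
    n                                 ∎)
    where open ≡-Reasoning

  count-Q : ∑[ x < n ] Q x ≡ p ^ k
  count-Q = count (p ^ k) q (a q) (trans (*-comm (p ^ k) q) n≡)

  count-R : ∀ {i} → i < k → ∑[ x < n ] R i x ≡ p ^ (k ∸ suc i)
  count-R {i} i<k =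
    count _ (q * p ^ suc i) (a (q * p ^ suc i)) {{m*n≢0 q (p ^ suc i) {{q≢0}} {{m^n≢0 p (suc i)}}}} (begin
    p ^ (k ∸ suc i) * (q * p ^ suc i) ≡⟨ x*[y*z]≡y*[x*z] (p ^ (k ∸ suc i)) q (p ^ suc i) ⟩
    q * (p ^ (k ∸ suc i) * p ^ suc i) ≡⟨ cong (q *_) (p^[k-i]*p^i≡p^k i<k) ⟩
    q * p ^ k                         ≡⟨ n≡ ⟩
    n                                 ∎)
    where
    open ≡-Reasoning
    x*[y*z]≡y*[x*z] : ∀ x y z → x * (y * z) ≡ y * (x * z)
    x*[y*z]≡y*[x*z] = ℕS.solve-∀

  count-P∩Q : ∀ {j} → j < k → ∑[ x < n ] (P j x * Q x) ≡ p ^ (k ∸ suc j)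
  count-P∩Q {j} j<k = begin
    ∑[ x < n ] (P j x * Q x)                       ≡⟨ ∑-cong {n} (λ x _ → 𝟙-× (inP? j x) (inQ? x)) ⟩
    ∑[ x < n ] 𝟙 (inP? j x ×-dec inQ? x)           ≡⟨ ∑-cong {n} (λ x _ → crt-indicator x) ⟨
    ∑[ x < n ] 𝟙 (≡-mod? (+ x) solution (p ^ suc j * q)) ≡⟨ count _ _ solution {{p^[1+j]*q≢0}} cofactor ⟩
    p ^ (k ∸ suc j)                                ∎
    where
    open ≡-Reasoning
    open CRT (prime∤⇒coprime pq (prime∤p^i pp pq p≢q (suc j))) (a (p ^ suc j)) (a q)
    p^[1+j]*q≢0 = m*n≢0 (p ^ suc j) q {{m^n≢0 p (suc j)}}
    crt-indicator : ∀ x → 𝟙 (≡-mod? (+ x) solution (p ^ suc j * q)) ≡ 𝟙 (inP? j x ×-dec inQ? x)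
    crt-indicator x =
      𝟙-cong (≡-mod-*⇔ (+ x)) (≡-mod? (+ x) solution (p ^ suc j * q)) (inP? j x ×-dec inQ? x)
    cofactor : p ^ (k ∸ suc j) * (p ^ suc j * q) ≡ n
    cofactor = begin
      p ^ (k ∸ suc j) * (p ^ suc j * q) ≡⟨ *-assoc (p ^ (k ∸ suc j)) _ q ⟨
      p ^ (k ∸ suc j) * p ^ suc j * q   ≡⟨ cong (_* q) (p^[k-i]*p^i≡p^k j<k) ⟩
      p ^ k * q                         ≡⟨ *-comm (p ^ k) q ⟩
      q * p ^ k                         ≡⟨ n≡ ⟩
      n                                 ∎

  G : ℕ
  G = ∑[ j < k ] (p ^ (k ∸ suc j))

  covered-count : ∑< n covered ≡ q * G + p ^ k
  covered-count = +-cancelʳ-≡ G _ _ (begin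
    ∑< n covered + G
      ≡⟨ cong (λ s → ∑< n covered + s) (∑-cong {k} (λ j j<k → count-P∩Q j<k)) ⟨
    ∑< n covered + ∑[ j < k ] ∑[ x < n ] (P j x * Q x)
      ≡⟨ cong (λ s → ∑< n covered + s) (∑-comm (λ x j → P j x * Q x) n k) ⟨
    ∑< n covered + ∑[ x < n ] ∑[ j < k ] (P j x * Q x)
      ≡⟨ ∑-distrib-+ covered (λ x → ∑[ j < k ] (P j x * Q x)) n ⟨
    ∑[ x < n ] (covered x + ∑[ j < k ] (P j x * Q x))
      ≡⟨ ∑-cong {n} (λ x _ → inclusion-exclusion x) ⟩
    ∑[ x < n ] (∑[ j < k ] P j x + Q x + ∑[ i < k ] R i x)
      ≡⟨ ∑-distrib-+ (λ x → ∑[ j < k ] P j x + Q x) (λ x → ∑[ i < k ] R i x) n ⟩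
    ∑[ x < n ] (∑[ j < k ] P j x + Q x) + ∑[ x < n ] ∑[ i < k ] R i x
      ≡⟨ cong (_+ ∑[ x < n ] ∑[ i < k ] R i x) (∑-distrib-+ (λ x → ∑[ j < k ] P j x) Q n) ⟩
    ∑[ x < n ] ∑[ j < k ] P j x + ∑< n Q + ∑[ x < n ] ∑[ i < k ] R i x
      ≡⟨ cong₂ (λ s t → s + ∑< n Q + t) (∑-comm (λ x j → P j x) n k) (∑-comm (λ x i → R i x) n k) ⟩
    ∑[ j < k ] ∑[ x < n ] P j x + ∑< n Q + ∑[ i < k ] ∑[ x < n ] R i x
      ≡⟨ cong₂ (λ s t → s + ∑< n Q + t) (∑-cong {k} (λ j j<k → count-P j<k))
                                         (∑-cong {k} (λ i i<k → count-R i<k)) ⟩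
    ∑[ j < k ] (q * p ^ (k ∸ suc j)) + ∑< n Q + G
      ≡⟨ cong₂ (λ s t → s + t + G) (∑-distribˡ-* q k) count-Q ⟩
    q * G + p ^ k + G
      ∎)
    where open ≡-Reasoning

  private
    covered-periodic : ∀ x → covered (x + n) ≡ covered x
    covered-periodic x = 𝟙-cong (mk⇔ shift⁻ shift) (covered? n a (+ (x + n))) (covered? n a (+ x))
      where
      shift⁻ : Covered n a (+ (x + n)) → Covered n a (+ x)
      shift⁻ (d , d∣n , 1<d , x+n≡a) = d , d∣n , 1<d , Equivalence.to (≡-mod-shift x (a d) d∣n) x+n≡a
      shift : Covered n a (+ x) → Covered n a (+ (x + n))
      shift (d , d∣n , 1<d , x≡a) = d , d∣n , 1<d , Equivalence.from (≡-mod-shift x (a d) d∣n) x≡a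

  density : HasDensity (countA n a) ((q * G + p ^ k) ÷ℕ n)
  density = HasDensity-cong (λ N → sym (length-filter≡∑𝟙 (λ x → covered? n a (+ x)) N))
    (subst (HasDensity _) (cong (_÷ℕ n) covered-count)
      (periodic-density covered m (λ x → 𝟙≤1 (covered? n a (+ x))) covered-periodic))

geometric-sum : ∀ p k → 1 ≤ p → ∑[ j < k ] (p ^ (k ∸ suc j)) * (p ∸ 1) + 1 ≡ p ^ k
geometric-sum p zero    _   = refl
geometric-sum p (suc k) 1≤p = begin
  (p ^ k + G) * (p ∸ 1) + 1       ≡⟨ expand (p ^ k) G (p ∸ 1) ⟩
  p ^ k * (p ∸ 1) + (G * (p ∸ 1) + 1) ≡⟨ cong (λ s → p ^ k * (p ∸ 1) + s) (geometric-sum p k 1≤p) ⟩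
  p ^ k * (p ∸ 1) + p ^ k         ≡⟨ cong (λ s → p ^ k * (p ∸ 1) + s) (*-identityʳ (p ^ k)) ⟨
  p ^ k * (p ∸ 1) + p ^ k * 1     ≡⟨ *-distribˡ-+ (p ^ k) (p ∸ 1) 1 ⟨
  p ^ k * (p ∸ 1 + 1)             ≡⟨ cong (p ^ k *_) (m∸n+n≡m 1≤p) ⟩
  p ^ k * p                       ≡⟨ *-comm (p ^ k) p ⟩
  p ^ suc k                       ∎
  where
  open ≡-Reasoning
  G = ∑[ j < k ] (p ^ (k ∸ suc j))
  expand : ∀ P G t → (P + G) * t + 1 ≡ P * t + (G * t + 1)
  expand = ℕS.solve-∀

density-value : ∀ p q k → 1 < p → .{{_ : NonZero q}} →
  ((p ^ k ∸ 1) ÷ℕ (p ^ k * (p ∸ 1))) ℚ.+ (1 ÷ℕ q) ≡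
  (q * ∑[ j < k ] (p ^ (k ∸ suc j)) + p ^ k) ÷ℕ (q * p ^ k)
density-value p q k 1<p = begin
  (p ^ k ∸ 1) ÷ℕ (p ^ k * t) ℚ.+ 1 ÷ℕ q
    ≡⟨ ÷ℕ-+-÷ℕ (p ^ k ∸ 1) (p ^ k * t) 1 q ⟩
  ((p ^ k ∸ 1) * q + 1 * (p ^ k * t)) ÷ℕ (p ^ k * t * q)
    ≡⟨ ÷ℕ-cong _ (p ^ k * t * q) _ (q * p ^ k) cross ⟩
  (q * G + p ^ k) ÷ℕ (q * p ^ k)
    ∎
  where
  open ≡-Reasoning
  t = p ∸ 1
  G = ∑[ j < k ] (p ^ (k ∸ suc j))
  instance
    p≢0 = ℕ.>-nonZero (<-trans z<s 1<p)
    t≢0 = ℕ.>-nonZero (m<n⇒0<n∸m 1<p)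
    p^k≢0 = m^n≢0 p k
    p^k*t≢0 = m*n≢0 (p ^ k) t
    p^k*t*q≢0 = m*n≢0 (p ^ k * t) q
    q*p^k≢0 = m*n≢0 q (p ^ k)
  p^k∸1≡G*t : p ^ k ∸ 1 ≡ G * t
  p^k∸1≡G*t = trans (cong (_∸ 1) (sym (geometric-sum p k (<⇒≤ 1<p)))) (m+n∸n≡m (G * t) 1)
  cross : ((p ^ k ∸ 1) * q + 1 * (p ^ k * t)) * (q * p ^ k) ≡ (q * G + p ^ k) * (p ^ k * t * q)
  cross = trans (cong (λ s → (s * q + 1 * (p ^ k * t)) * (q * p ^ k)) p^k∸1≡G*t) (ring G t q (p ^ k))
    where
    ring : ∀ G t q P → (G * t * q + 1 * (P * t)) * (q * P) ≡ (q * G + P) * (P * t * q)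
    ring = ℕS.solve-∀

cd-density : ∀ {p q} → Prime p → Prime q → p ≢ q → ∀ k a → IsCDSet (q * p ^ k) a →
  HasDensity (countA (q * p ^ k) a) ((q * ∑[ j < k ] (p ^ (k ∸ suc j)) + p ^ k) ÷ℕ (q * p ^ k))
-- countA computes only on a successor.
cd-density {p} {q} pp pq p≢q k a cd with q * p ^ k in n≡
... | suc m = CoveredCount.density {k = k} pp pq p≢q n≡ a cd
... | zero  = contradiction n≡ (ℕ.≢-nonZero⁻¹ _ {{m*n≢0 q (p ^ k) {{q≢0}} {{m^n≢0 p k {{p≢0}}}}}})
  where
  p≢0 = prime⇒nonZero pp
  q≢0 = prime⇒nonZero pq

proposition3 : (p q k : ℕ) → Prime p → Prime q → p ≢ q → 1 ≤ k →
    (NonIntersecting (q * p ^ k) ⇔ (k ≡ 1 ⊎ 2 < p)) ×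
    (∀ a → IsCDSet (q * p ^ k) a →
    HasDensity (countA (q * p ^ k) a)
    (((p ^ k ∸ 1) ÷ℕ (p ^ k * (p ∸ 1))) ℚ.+ (1 ÷ℕ q)))
proposition3 p q k pp pq p≢q 1≤k =
  mk⇔ (nonIntersecting⇒k≡1⊎2<p pp pq p≢q 1≤k)
      (λ k≡1⊎2<p → cdResidue p q , CDConstruction.cdResidue-isCD pp pq p≢q k≡1⊎2<p) ,
  λ a cd → subst (HasDensity (countA (q * p ^ k) a)) (sym (density-value p q k (prime⇒1< pp)))
                 (cd-density pp pq p≢q k a cd)
  where instance
    p≢0 = prime⇒nonZero pp
    q≢0 = prime⇒nonZero pq
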